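{- Let $M$ be a matroid with ground set $T$, and $M'$ an extension of $M$ with ground set $E'$ and rank function $\operatorname{rk}'$. Let $X,Y\subseteq E'$ be such that $X\cap T=l_X$ and $Y\cap T=l_Y$ are two disjoint coplanar lines of $M$ and $X\cap Y$ is a flat of $M'$. Assume moreover that $X\setminus T\subseteq Y$ and that $(X,Y)$ is a modular pair in $M'$, i.e. $\operatorname{rk}'(X)+\operatorname{rk}'(Y)=\operatorname{rk}'(X\cup Y)+\operatorname{rk}'(X\cap Y)$. Then $x\notin\operatorname{cl}_{M'}(Y)$ for all $x\in l_X$.
   Context: Lines are flats of rank $2$; two lines are coplanar if their union has rank $3$. An extension of $M$ is a matroid on a superset of $T$ whose restriction to $T$ is $M$. -}

module Defs where

open import Data.Nat using (ℕ; _≤_; _<_; _+_)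
open import Data.Bool using (Bool; true; false; if_then_else_)
open import Data.Fin using (Fin; zero; suc)
open import Data.Fin.Subset using (Subset; _∈_; _∉_; _⊆_; _∪_; _∩_; ⁅_⁆; ⊥; ⊤; ∣_∣)
open import Data.Vec using ([]; _∷_)
open import Function using (_∘_)
open import Function.Definitions using (Injective)
open import Relation.Binary.PropositionalEquality using (_≡_)

record Matroid (n : ℕ) : Set where
  field
    rk      : Subset n → ℕ
    rk-card : ∀ A → rk A ≤ ∣ A ∣
    rk-mono : ∀ {A B} → A ⊆ B → rk A ≤ rk B
    rk-sub  : ∀ A B → rk (A ∪ B) + rk (A ∩ B) ≤ rk A + rk B
open Matroid public

image : ∀ {m n} → (Fin m → Fin n) → Subset m → Subset n
image f []      = ⊥
image f (b ∷ A) = (if b then ⁅ f zero ⁆ else ⊥) ∪ image (f ∘ suc) A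

_∈cl[_]_ : ∀ {n} → Fin n → Matroid n → Subset n → Set
e ∈cl[ M ] A = rk M (A ∪ ⁅ e ⁆) ≡ rk M A

IsFlat : ∀ {n} → Matroid n → Subset n → Set
IsFlat M F = ∀ e → e ∈cl[ M ] F → e ∈ F

IsLine : ∀ {n} → Matroid n → Subset n → Set
IsLine M l = IsFlat M l × rk M l ≡ 2
  where open import Data.Product using (_×_)

Coplanar : ∀ {n} → Matroid n → Subset n → Subset n → Set
Coplanar M l₁ l₂ = rk M (l₁ ∪ l₂) ≡ 3

-- M' is an extension of M via the identification ι of the ground set of M
-- with a subset T = ι(Fin m) of the ground set of M': ι is injective and the
-- restriction of M' to T is M.
record IsExtension {m n} (M : Matroid m) (M' : Matroid n) (ι : Fin m → Fin n) : Set where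
  field
    inj     : Injective _≡_ _≡_ ι
    restrict : ∀ A → rk M A ≡ rk M' (image ι A)

-- If ι x lay in cl(Y), then, x lying in X, submodularity applied to X and Y ∪ {ι x}
-- together with the modularity of (X, Y) gives rk((X ∩ Y) ∪ {ι x}) = rk(X ∩ Y).
-- As X ∩ Y is a flat, ι x ∈ X ∩ Y, so ι x ∈ Y ∩ T and x ∈ l_Y, contradicting
-- the disjointness of the two lines.
module Submission where

open import Defs
open import Data.Nat using (_+_; _≤_)
open import Data.Nat.Properties using (≤-trans; ≤-antisym; +-cancelˡ-≤; +-monoˡ-≤; module ≤-Reasoning)
open import Data.Fin using (Fin; zero; suc)
open import Data.Fin.Subset using (Subset; _∈_; _∉_; _⊆_; _∪_; _∩_; ⁅_⁆; ⊥; ⊤)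
open import Data.Fin.Subset.Properties
  using (∉⊥; ∈⊤; x∈⁅x⁆; x∈⁅y⁆⇒x≡y; p⊆p∪q; q⊆p∪q; x∈p∪q⁻; x∈p∩q⁺; x∈p∩q⁻)
open import Data.Bool using (true; false)
open import Data.Vec using (_∷_; []; here; there)
open import Data.Product using (∃; _×_; _,_)
open import Data.Sum using (inj₁; inj₂)
open import Data.Empty using (⊥-elim)
open import Function using (_∘_)
open import Function.Definitions using (Injective)
open import Relation.Binary.PropositionalEquality using (_≡_; sym; cong; subst)
open import Relation.Nullary using (¬_)

∈-image⁺ : ∀ {m n} (f : Fin m → Fin n) {A : Subset m} {x} → x ∈ A → f x ∈ image f A
∈-image⁺ f {true ∷ A} {zero}  here      = p⊆p∪q (image (f ∘ suc) A) (x∈⁅x⁆ (f zero))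
∈-image⁺ f {b ∷ A}    {suc x} (there p) = q⊆p∪q _ _ (∈-image⁺ (f ∘ suc) p)

∈-image⁻ : ∀ {m n} (f : Fin m → Fin n) {A : Subset m} {y} → y ∈ image f A → ∃ λ i → f i ≡ y × i ∈ A
∈-image⁻ f {[]} p = ⊥-elim (∉⊥ p)
∈-image⁻ f {b ∷ A} p with b | x∈p∪q⁻ _ (image (f ∘ suc) A) p
... | true  | inj₁ q = zero , sym (x∈⁅y⁆⇒x≡y (f zero) q) , here
... | false | inj₁ q = ⊥-elim (∉⊥ q)
... | _     | inj₂ q with ∈-image⁻ (f ∘ suc) q
...   | i , fi≡y , i∈A = suc i , fi≡y , there i∈A

∈-image-injective⁻ : ∀ {m n} {f : Fin m → Fin n} {A : Subset m} {x} →
                     Injective _≡_ _≡_ f → f x ∈ image f A → x ∈ A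
∈-image-injective⁻ f-inj fx∈ with ∈-image⁻ _ fx∈
... | i , fi≡fx , i∈A = subst (_∈ _) (f-inj fi≡fx) i∈A

∪-monoʳ-⊆ : ∀ {n} (p : Subset n) {q r : Subset n} → q ⊆ r → p ∪ q ⊆ p ∪ r
∪-monoʳ-⊆ p {q} q⊆r x∈ with x∈p∪q⁻ p q x∈
... | inj₁ x∈p = p⊆p∪q _ x∈p
... | inj₂ x∈q = q⊆p∪q p _ (q⊆r x∈q)

∩-∪-⁅⁆-⊆ : ∀ {n} {X : Subset n} (Y : Subset n) {e} → e ∈ X → (X ∩ Y) ∪ ⁅ e ⁆ ⊆ X ∩ (Y ∪ ⁅ e ⁆)
∩-∪-⁅⁆-⊆ {X = X} Y {e} e∈X x∈ with x∈p∪q⁻ (X ∩ Y) ⁅ e ⁆ x∈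
... | inj₁ x∈X∩Y with x∈p∩q⁻ X Y x∈X∩Y
...   | x∈X , x∈Y = x∈p∩q⁺ (x∈X , p⊆p∪q ⁅ e ⁆ x∈Y)
∩-∪-⁅⁆-⊆ {X = X} Y {e} e∈X x∈ | inj₂ x∈⁅e⁆ rewrite x∈⁅y⁆⇒x≡y e x∈⁅e⁆ =
  x∈p∩q⁺ (e∈X , q⊆p∪q Y ⁅ e ⁆ (x∈⁅x⁆ e))

IsModularPair : ∀ {n} → Matroid n → Subset n → Subset n → Set
IsModularPair M X Y = rk M X + rk M Y ≡ rk M (X ∪ Y) + rk M (X ∩ Y)

∈cl-∩-modular : ∀ {n} (M : Matroid n) {X Y : Subset n} {e} →
                IsModularPair M X Y → e ∈ X → e ∈cl[ M ] Y → e ∈cl[ M ] (X ∩ Y)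
∈cl-∩-modular M {X} {Y} {e} modular e∈X e∈clY =
  ≤-antisym (≤-trans (rk-mono M (∩-∪-⁅⁆-⊆ Y e∈X)) rk-X∩Ye≤rk-X∩Y) (rk-mono M (p⊆p∪q ⁅ e ⁆))
  where
  Ye : Subset _
  Ye = Y ∪ ⁅ e ⁆

  rk-X∩Ye≤rk-X∩Y : rk M (X ∩ Ye) ≤ rk M (X ∩ Y)
  rk-X∩Ye≤rk-X∩Y = +-cancelˡ-≤ (rk M (X ∪ Y)) _ _ (begin
    rk M (X ∪ Y) + rk M (X ∩ Ye)   ≤⟨ +-monoˡ-≤ _ (rk-mono M (∪-monoʳ-⊆ X (p⊆p∪q ⁅ e ⁆))) ⟩
    rk M (X ∪ Ye) + rk M (X ∩ Ye)  ≤⟨ rk-sub M X Ye ⟩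
    rk M X + rk M Ye               ≡⟨ cong (rk M X +_) e∈clY ⟩
    rk M X + rk M Y                ≡⟨ modular ⟩
    rk M (X ∪ Y) + rk M (X ∩ Y)    ∎)
    where open ≤-Reasoning

proposition7 : ∀ {m n} (M : Matroid m) (M' : Matroid n) (ι : Fin m → Fin n)
    → IsExtension M M' ι
    → (X Y : Subset n) (lX lY : Subset m)
    → X ∩ image ι ⊤ ≡ image ι lX
    → Y ∩ image ι ⊤ ≡ image ι lY
    → IsLine M lX → IsLine M lY
    → lX ∩ lY ≡ ⊥
    → Coplanar M lX lY
    → IsFlat M' (X ∩ Y)
    → (∀ e → e ∈ X → e ∉ image ι ⊤ → e ∈ Y)
    → rk M' X + rk M' Y ≡ rk M' (X ∪ Y) + rk M' (X ∩ Y)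
    → ∀ x → x ∈ lX → ¬ (ι x ∈cl[ M' ] Y)
proposition7 M M' ι ext X Y lX lY X∩T≡lX Y∩T≡lY _ _ lX∩lY≡⊥ _ X∩Y-flat _ modular x x∈lX ιx∈clY =
  ∉⊥ (subst (x ∈_) lX∩lY≡⊥ (x∈p∩q⁺ (x∈lX , x∈lY)))
  where
  ιx∈X : ι x ∈ X
  ιx∈X with x∈p∩q⁻ X _ (subst (ι x ∈_) (sym X∩T≡lX) (∈-image⁺ ι x∈lX))
  ... | ιx∈X , _ = ιx∈X

  ιx∈X∩Y : ι x ∈ X ∩ Y
  ιx∈X∩Y = X∩Y-flat (ι x) (∈cl-∩-modular M' modular ιx∈X ιx∈clY)

  x∈lY : x ∈ lY
  x∈lY with x∈p∩q⁻ X Y ιx∈X∩Y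
  ... | _ , ιx∈Y = ∈-image-injective⁻ (IsExtension.inj ext)
                     (subst (ι x ∈_) Y∩T≡lY (x∈p∩q⁺ (ιx∈Y , ∈-image⁺ ι ∈⊤)))
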